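{- For every integer $\Delta\ge 4$ and every odd integer $d\ge 1$, there exists a graph with maximum degree at most $\Delta$ containing a distance-$d$ half graph of order $\left\lfloor \frac{\Delta}{2}\right\rfloor^{\left\lceil \frac{d}{2}\right\rceil}$.
   Context: All graphs are finite, undirected and simple; $\mathrm{dist}$ is the shortest-path distance. For integers $d,\ell\ge1$, $2\ell$ pairwise distinct vertices $a_1,\dots,a_\ell,b_1,\dots,b_\ell$ of a graph form a distance-$d$ half graph of order $\ell$ if for all $i,j\in[1,\ell]$ we have $\mathrm{dist}(b_i,a_j)\le d$ if and only if $i<j$. -}

module Defs where

open import Data.Nat using (ℕ; zero; suc; _≤_; _<_; _^_; _/_; _+_)
open import Data.Bool using (Bool; true; false; T)
open import Data.Fin using (Fin; toℕ)
open import Data.List using (length; filter; allFin)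
open import Data.Sum using (_⊎_; inj₁; inj₂)
open import Data.Product using (Σ; ∃; _×_; _,_)
open import Relation.Binary.PropositionalEquality using (_≡_)
open import Relation.Nullary using (¬_)
open import Relation.Nullary.Decidable using (T?)
open import Function.Definitions using (Injective)

record Graph : Set where
  field
    n     : ℕ
    adj   : Fin n → Fin n → Bool
    sym   : ∀ u v → adj u v ≡ adj v u
    irrefl : ∀ v → adj v v ≡ false

open Graph public

Adj : (G : Graph) → Fin (n G) → Fin (n G) → Set
Adj G u v = T (adj G u v)

degree : (G : Graph) → Fin (n G) → ℕ
degree G v = length (filter (λ u → T? (adj G v u)) (allFin (n G)))

MaxDegreeAtMost : Graph → ℕ → Set
MaxDegreeAtMost G Δ = ∀ v → degree G v ≤ Δ

data Walk (G : Graph) : Fin (n G) → Fin (n G) → ℕ → Set where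
  here : ∀ {u} → Walk G u u zero
  step : ∀ {u w v k} → Adj G u w → Walk G w v k → Walk G u v (suc k)

DistLe : (G : Graph) → Fin (n G) → Fin (n G) → ℕ → Set
DistLe G u v d = Σ ℕ λ k → k ≤ d × Walk G u v k

-- Vertices a_i = f (inj₁ i), b_i = f (inj₂ i) for i ∈ Fin ℓ (indices 0..ℓ-1,
-- order-isomorphic to 1..ℓ); pairwise distinct = f injective.
record HalfGraph (G : Graph) (d ℓ : ℕ) : Set where
  field
    f        : Fin ℓ ⊎ Fin ℓ → Fin (n G)
    distinct : Injective _≡_ _≡_ f
    half     : ∀ (i j : Fin ℓ) →
               (DistLe G (f (inj₂ i)) (f (inj₁ j)) d → toℕ i < toℕ j)
               × (toℕ i < toℕ j → DistLe G (f (inj₂ i)) (f (inj₁ j)) d)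

ceilHalf : ℕ → ℕ
ceilHalf m = (m + 1) / 2

Odd : ℕ → Set
Odd m = Σ ℕ λ k → m ≡ suc (k + k)

{-# OPTIONS --safe #-}
-- With k = ⌊Δ/2⌋ and m = ⌈d/2⌉, take two k-ary trees of height m - 1 whose leaves are the
-- b_i and the a_j, and join node q of the b-tree to node q′ of the a-tree at the same height h,
-- whenever q is a left sibling of q′, by a path of length d - 2h. Putting b-tree nodes of height
-- h in layer h, a-tree nodes of height h in layer d - h and path vertices in between, every edge
-- joins consecutive layers. A walk of length at most d from b_i (layer 0) to a_j (layer d) must
-- therefore only climb, and along it the ancestor of i at the current height stays weakly left of
-- the current node, strictly once the walk has crossed; so i < j. Conversely, for i < j climb
-- from b_i to the level just below the lowest common ancestor of i and j, cross to the sibling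
-- and descend to a_j: this has length exactly d. Each vertex has a parent, k children and fewer
-- than k relevant siblings, so degrees are at most 2k ≤ Δ.

module Submission where

open import Defs hiding (sym)
open import Data.Bool using (Bool; false; T; _∨_)
open import Data.Bool.Properties using (∨-comm)
open import Data.Empty using (⊥; ⊥-elim)
open import Data.Fin using (Fin; toℕ; fromℕ<)
open import Data.Fin.Properties using (toℕ-fromℕ<; fromℕ<-toℕ; toℕ-injective; toℕ<n; +↔⊎; *↔×)
open import Data.List using (List; []; _∷_; _++_; length; filter; map; allFin; applyUpTo)
open import Data.List.Membership.Propositional using (_∈_; _─_)
open import Data.List.Membership.Propositional.Properties using (∈-map⁻; ∈-filter⁻; ∈-applyUpTo⁺; ∈-++⁺ˡ; ∈-++⁺ʳ)
open import Data.List.Properties using (length-map; length-++; length-applyUpTo; length-removeAt′)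
open import Data.List.Relation.Unary.All using (lookup)
open import Data.List.Relation.Unary.AllPairs using (_∷_)
open import Data.List.Relation.Unary.Any using (here; there)
open import Data.List.Relation.Unary.Unique.Propositional using (Unique)
import Data.List.Relation.Unary.Unique.Propositional.Properties as Unique
open import Data.Nat
open import Data.Nat.DivMod
open import Data.Nat.Properties
open import Data.Product using (Σ; ∃; _×_; _,_; proj₁; proj₂)
open import Data.Product.Function.NonDependent.Propositional using (_×-cong_)
open import Data.Sum using (_⊎_; inj₁; inj₂)
open import Data.Sum.Function.Propositional using (_⊎-cong_)
open import Function.Bundles using (_↔_; Inverse; Injection)
open import Function.Definitions using (Injective)
open import Function.Properties.Inverse using (↔-trans; ↔-refl; ↔⇒↣)
open import Relation.Binary.Construct.Closure.ReflexiveTransitive using (Star; ε; _◅_; _◅◅_)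
open import Relation.Binary.PropositionalEquality
open import Relation.Nullary using (Dec; yes; no; does; ¬_)
open import Relation.Nullary.Decidable using (T?; _×-dec_)

∈-─⁺ : ∀ {A : Set} {x z : A} {ys : List A} (p : x ∈ ys) → z ∈ ys → z ≢ x → z ∈ ys ─ p
∈-─⁺ (here refl) (here refl) z≢x = ⊥-elim (z≢x refl)
∈-─⁺ (here refl) (there z∈ys) _ = z∈ys
∈-─⁺ (there p) (here refl) _ = here refl
∈-─⁺ (there p) (there z∈ys) z≢x = there (∈-─⁺ p z∈ys z≢x)

Unique-⊆⇒length≤ : ∀ {A : Set} {xs ys : List A} → Unique xs → (∀ {z} → z ∈ xs → z ∈ ys) → length xs ≤ length ys
Unique-⊆⇒length≤ {xs = []} _ _ = z≤n
Unique-⊆⇒length≤ {xs = x ∷ xs} {ys} (x∉xs ∷ unique) xs⊆ys = begin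
  suc (length xs)          ≤⟨ s≤s (Unique-⊆⇒length≤ unique xs⊆ys─x) ⟩
  suc (length (ys ─ x∈ys)) ≡⟨ length-removeAt′ ys _ ⟨
  length ys                ∎
  where
  open ≤-Reasoning
  x∈ys : x ∈ ys
  x∈ys = xs⊆ys (here refl)
  xs⊆ys─x : ∀ {z} → z ∈ xs → z ∈ ys ─ x∈ys
  xs⊆ys─x z∈xs = ∈-─⁺ x∈ys (xs⊆ys (there z∈xs)) λ { refl → lookup x∉xs z∈xs refl }

exit-point : ∀ {P : ℕ → Set} → (∀ h → Dec (P h)) → ∀ {m} → P 0 → ¬ P m →
             ∃ λ h → h < m × P h × ¬ P (suc h)
exit-point P? {zero} P0 ¬P0 = ⊥-elim (¬P0 P0)
exit-point P? {suc m} P0 ¬Pm+1 with P? m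
... | yes Pm = m , n<1+n m , Pm , ¬Pm+1
... | no ¬Pm with h , h<m , Ph , ¬Ph+1 ← exit-point P? P0 ¬Pm = h , m<n⇒m<1+n h<m , Ph , ¬Ph+1

m∸n≡1+m∸1+n : ∀ {m n} → n < m → m ∸ n ≡ suc (m ∸ suc n)
m∸n≡1+m∸1+n {suc m} {zero} _ = refl
m∸n≡1+m∸1+n {suc m} {suc n} n<m = m∸n≡1+m∸1+n (s≤s⁻¹ n<m)

-- Fin size enumerates (at least) the elements of V satisfying InRange.
record Enumeration (V : Set) : Set₁ where
  field
    size             : ℕ
    decode           : Fin size → V
    decode-injective : Injective _≡_ _≡_ decode
    InRange          : V → Set
    encode           : (v : V) → .(InRange v) → Fin size
    decode-encode    : ∀ v .(p : InRange v) → decode (encode v p) ≡ v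

module GradedGraph {V : Set} (E : V → V → Set) (E? : ∀ v w → Dec (E v w))
                   (layer : V → ℕ) (layer-step : ∀ {v w} → E v w → layer w ≡ suc (layer v))
                   (enum : Enumeration V) where

  open Enumeration enum

  E-irreflexive : ∀ {v} → ¬ E v v
  E-irreflexive e = 1+n≢n (sym (layer-step e))

  adjacent : Fin size → Fin size → Bool
  adjacent x y = does (E? (decode x) (decode y)) ∨ does (E? (decode y) (decode x))

  adjacent-irrefl : ∀ x → adjacent x x ≡ false
  adjacent-irrefl x with E? (decode x) (decode x)
  ... | yes e = ⊥-elim (E-irreflexive e)
  ... | no _ = refl

  graph : Graph
  graph = record
    { n = size
    ; adj = adjacent
    ; sym = λ x y → ∨-comm (does (E? (decode x) (decode y))) (does (E? (decode y) (decode x)))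
    ; irrefl = adjacent-irrefl
    }

  Adj⇒E⊎E˘ : ∀ {x y} → Adj graph x y → E (decode x) (decode y) ⊎ E (decode y) (decode x)
  Adj⇒E⊎E˘ {x} {y} xy with E? (decode x) (decode y) | E? (decode y) (decode x)
  ... | yes e | _ = inj₁ e
  ... | no _ | yes e = inj₂ e

  E⇒Adj : ∀ {x y} → E (decode x) (decode y) → Adj graph x y
  E⇒Adj {x} {y} e with E? (decode x) (decode y)
  ... | yes _ = _
  ... | no ¬e = ⊥-elim (¬e e)

  degree≤length : (neighbours : V → List V) →
                  (∀ {v w} → E v w → w ∈ neighbours v) → (∀ {v w} → E w v → w ∈ neighbours v) →
                  ∀ x → degree graph x ≤ length (neighbours (decode x))
  degree≤length neighbours out-neighbour in-neighbour x = begin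
    length xs            ≡⟨ length-map decode xs ⟨
    length (map decode xs) ≤⟨ Unique-⊆⇒length≤ unique ⊆neighbours ⟩
    length (neighbours (decode x)) ∎
    where
    open ≤-Reasoning
    adjacent? : ∀ y → Dec (T (adjacent x y))
    adjacent? y = T? (adjacent x y)
    xs : List (Fin size)
    xs = filter adjacent? (allFin size)
    unique : Unique (map decode xs)
    unique = Unique.map⁺ decode-injective (Unique.filter⁺ adjacent? (Unique.allFin⁺ size))
    ⊆neighbours : ∀ {w} → w ∈ map decode xs → w ∈ neighbours (decode x)
    ⊆neighbours w∈ with y , y∈xs , refl ← ∈-map⁻ decode w∈
      with Adj⇒E⊎E˘ {x} {y} (proj₂ (∈-filter⁻ adjacent? {xs = allFin size} y∈xs))
    ... | inj₁ e = out-neighbour e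
    ... | inj₂ e = in-neighbour e

  forward-layer : ∀ {v w} l → E v w → l + layer w ≡ suc l + layer v
  forward-layer {v} l e = trans (cong (l +_) (layer-step e)) (+-suc l (layer v))

  layer-descends : ∀ {v w} → E w v → layer w ≤ layer v
  layer-descends e = ≤-trans (n≤1+n _) (≤-reflexive (sym (layer-step e)))

  walk-layer≤ : ∀ {x y l} → Walk graph x y l → layer (decode y) ≤ l + layer (decode x)
  walk-layer≤ here = ≤-refl
  walk-layer≤ (step {k = l} xw walk) with Adj⇒E⊎E˘ xw
  ... | inj₁ e = ≤-trans (walk-layer≤ walk) (≤-reflexive (forward-layer l e))
  ... | inj₂ e = ≤-trans (walk-layer≤ walk) (≤-trans (+-monoʳ-≤ l (layer-descends e)) (n≤1+n _))

  -- A walk exactly as long as the layer gap it climbs uses only forward edges.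
  tight-walk-preserves : ∀ {P : V → Set} → (∀ {v w} → E v w → P v → P w) →
                         ∀ {x y l} → Walk graph x y l → layer (decode y) ≡ l + layer (decode x) →
                         P (decode x) → P (decode y)
  tight-walk-preserves P-step here _ Px = Px
  tight-walk-preserves P-step (step {k = l} xw walk) tight Px with Adj⇒E⊎E˘ xw
  ... | inj₁ e = tight-walk-preserves P-step walk (trans tight (sym (forward-layer l e))) (P-step e Px)
  ... | inj₂ e = ⊥-elim (<-irrefl tight (s≤s (≤-trans (walk-layer≤ walk) (+-monoʳ-≤ l (layer-descends e)))))

  Forward : V → V → Set
  Forward v w = InRange w × E v w

  forward-walk : ∀ {v w} → Star Forward v w → .(p : InRange v) .(q : InRange w) →
                 Σ ℕ λ l → Walk graph (encode v p) (encode w q) l × layer w ≡ l + layer v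
  forward-walk ε _ _ = 0 , here , refl
  forward-walk {v} ((pu , e) ◅ s) p q with l , walk , climb ← forward-walk s pu q =
    suc l , step (E⇒Adj (subst₂ E (sym (decode-encode v p)) (sym (decode-encode _ pu)) e)) walk ,
    trans climb (forward-layer l e)

  short-walk-preserves : ∀ {P : V → Set} → (∀ {v w} → E v w → P v → P w) →
                         ∀ {v w l} .{p : InRange v} .{q : InRange w} →
                         Walk graph (encode v p) (encode w q) l → l + layer v ≤ layer w → P v → P w
  short-walk-preserves {P} P-step {v} {w} {l} {p} {q} walk short Pv =
    subst P (decode-encode w q) (tight-walk-preserves P-step walk tight (subst P (sym (decode-encode v p)) Pv))
    where
    tight : layer (decode (encode w q)) ≡ l + layer (decode (encode v p))
    tight = ≤-antisym (walk-layer≤ walk)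
              (subst₂ (λ a b → l + layer a ≤ layer b) (sym (decode-encode v p)) (sym (decode-encode w q)) short)

module HalfGraphConstruction (k : ℕ) .{{_ : NonZero k}} (r : ℕ) where

  m d N : ℕ
  m = suc r
  d = suc (r + r)
  N = k ^ m

  -- B q h is node q at height h of the k-ary tree above the leaves b_i = B i 0, and A q h
  -- likewise above a_j = A j 0; X q q′ h t is the vertex in layer t of the bridge from
  -- B q h to A q′ h.
  data V : Set where
    B A : (q h : ℕ) → V
    X   : (q q′ h t : ℕ) → V

  LeftSibling : ℕ → ℕ → Set
  LeftSibling q q′ = q / k ≡ q′ / k × q < q′

  LeftSibling? : ∀ q q′ → Dec (LeftSibling q q′)
  LeftSibling? q q′ = (q / k ≟ q′ / k) ×-dec (q <? q′)

  -- Edges point up one layer. A bridge of length 1 is a single edge B q h → A q′ h.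
  -- The side condition h ≤ d on A-edges stops d ∸ h from truncating.
  E : V → V → Set
  E (B q h)      (B q₁ h₁)        = h₁ ≡ suc h × q₁ ≡ q / k
  E (A q h)      (A q₁ h₁)        = h ≡ suc h₁ × q ≡ q₁ / k × h ≤ d
  E (B q h)      (A q′ h′)        = h′ ≡ h × LeftSibling q q′ × suc h ≡ d ∸ h
  E (B q h)      (X q₁ q′ h′ t)   = q₁ ≡ q × h′ ≡ h × LeftSibling q q′ × t ≡ suc h × suc h < d ∸ h
  E (X q q′ h t) (X q₁ q₁′ h′ t′) = q₁ ≡ q × q₁′ ≡ q′ × h′ ≡ h × t′ ≡ suc t
  E (X q q′ h t) (A q₁′ h′)       = q₁′ ≡ q′ × h′ ≡ h × LeftSibling q q′ × h < t × suc t ≡ d ∸ h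
  E _ _ = ⊥

  E? : ∀ v w → Dec (E v w)
  E? (B q h)      (B q₁ h₁)        = (h₁ ≟ suc h) ×-dec (q₁ ≟ q / k)
  E? (A q h)      (A q₁ h₁)        = (h ≟ suc h₁) ×-dec (q ≟ q₁ / k) ×-dec (h ≤? d)
  E? (B q h)      (A q′ h′)        = (h′ ≟ h) ×-dec LeftSibling? q q′ ×-dec (suc h ≟ d ∸ h)
  E? (B q h)      (X q₁ q′ h′ t)   = (q₁ ≟ q) ×-dec (h′ ≟ h) ×-dec LeftSibling? q q′ ×-dec (t ≟ suc h) ×-dec (suc h <? d ∸ h)
  E? (X q q′ h t) (X q₁ q₁′ h′ t′) = (q₁ ≟ q) ×-dec (q₁′ ≟ q′) ×-dec (h′ ≟ h) ×-dec (t′ ≟ suc t)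
  E? (X q q′ h t) (A q₁′ h′)       = (q₁′ ≟ q′) ×-dec (h′ ≟ h) ×-dec LeftSibling? q q′ ×-dec (h <? t) ×-dec (suc t ≟ d ∸ h)
  E? (A _ _)      (B _ _)          = no λ ()
  E? (A _ _)      (X _ _ _ _)      = no λ ()
  E? (X _ _ _ _)  (B _ _)          = no λ ()

  layer : V → ℕ
  layer (B q h)      = h
  layer (A q h)      = d ∸ h
  layer (X q q′ h t) = t

  layer-step : ∀ {v w} → E v w → layer w ≡ suc (layer v)
  layer-step {B _ _}      {B _ _}      (h₁≡h+1 , _)             = h₁≡h+1
  layer-step {A _ _}      {A _ _}      (refl , _ , h≤d)         = m∸n≡1+m∸1+n h≤d
  layer-step {B _ _}      {A _ _}      (refl , _ , h+1≡d∸h)     = sym h+1≡d∸h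
  layer-step {B _ _}      {X _ _ _ _}  (_ , _ , _ , t≡h+1 , _)  = t≡h+1
  layer-step {X _ _ _ _}  {X _ _ _ _}  (_ , _ , _ , t′≡t+1)     = t′≡t+1
  layer-step {X _ _ _ _}  {A _ _}      (_ , refl , _ , _ , t+1≡d∸h) = sym t+1≡d∸h

  InRange : V → Set
  InRange (B q h)      = q < N × h < m
  InRange (A q h)      = q < N × h < m
  InRange (X q q′ h t) = q < N × q′ < N × h < m × t < suc d

  Code : Set
  Code = Fin N × Fin m ⊎ Fin N × Fin m ⊎ Fin N × Fin N × Fin m × Fin (suc d)

  size : ℕ
  size = N * m + (N * m + N * (N * (m * suc d)))

  Fin-size↔Code : Fin size ↔ Code
  Fin-size↔Code = ↔-trans +↔⊎ (*↔× ⊎-cong (↔-trans +↔⊎ (*↔× ⊎-cong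
                    (↔-trans *↔× (↔-refl ×-cong (↔-trans *↔× (↔-refl ×-cong *↔×)))))))

  vertex : Code → V
  vertex (inj₁ (q , h))                 = B (toℕ q) (toℕ h)
  vertex (inj₂ (inj₁ (q , h)))          = A (toℕ q) (toℕ h)
  vertex (inj₂ (inj₂ (q , q′ , h , t))) = X (toℕ q) (toℕ q′) (toℕ h) (toℕ t)

  vertex-in-range : ∀ c → InRange (vertex c)
  vertex-in-range (inj₁ (q , h))                 = toℕ<n q , toℕ<n h
  vertex-in-range (inj₂ (inj₁ (q , h)))          = toℕ<n q , toℕ<n h
  vertex-in-range (inj₂ (inj₂ (q , q′ , h , t))) = toℕ<n q , toℕ<n q′ , toℕ<n h , toℕ<n t

  code : (v : V) → .(InRange v) → Code
  code (B q h)      p = inj₁ (fromℕ< (proj₁ p) , fromℕ< (proj₂ p))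
  code (A q h)      p = inj₂ (inj₁ (fromℕ< (proj₁ p) , fromℕ< (proj₂ p)))
  code (X q q′ h t) p = inj₂ (inj₂ (fromℕ< (proj₁ p) , fromℕ< (proj₁ (proj₂ p)) ,
                                    fromℕ< (proj₁ (proj₂ (proj₂ p))) , fromℕ< (proj₂ (proj₂ (proj₂ p)))))

  vertex-code : ∀ v .(p : InRange v) → vertex (code v p) ≡ v
  vertex-code (B q h) p = cong₂ B (toℕ-fromℕ< (proj₁ p)) (toℕ-fromℕ< (proj₂ p))
  vertex-code (A q h) p = cong₂ A (toℕ-fromℕ< (proj₁ p)) (toℕ-fromℕ< (proj₂ p))
  vertex-code (X q q′ h t) p
    rewrite toℕ-fromℕ< (proj₁ p) | toℕ-fromℕ< (proj₁ (proj₂ p))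
          | toℕ-fromℕ< (proj₁ (proj₂ (proj₂ p))) | toℕ-fromℕ< (proj₂ (proj₂ (proj₂ p))) = refl

  code-vertex : ∀ c → code (vertex c) (vertex-in-range c) ≡ c
  code-vertex (inj₁ (q , h)) = cong₂ (λ q h → inj₁ (q , h)) (fromℕ<-toℕ q _) (fromℕ<-toℕ h _)
  code-vertex (inj₂ (inj₁ (q , h))) = cong₂ (λ q h → inj₂ (inj₁ (q , h))) (fromℕ<-toℕ q _) (fromℕ<-toℕ h _)
  code-vertex (inj₂ (inj₂ (q , q′ , h , t)))
    rewrite fromℕ<-toℕ q (toℕ<n q) | fromℕ<-toℕ q′ (toℕ<n q′)
          | fromℕ<-toℕ h (toℕ<n h) | fromℕ<-toℕ t (toℕ<n t) = refl

  code-cong : ∀ {v w} (v≡w : v ≡ w) .(p : InRange v) → code v p ≡ code w (subst InRange v≡w p)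
  code-cong refl _ = refl

  vertex-injective : Injective _≡_ _≡_ vertex
  vertex-injective {c} {c′} eq =
    trans (sym (code-vertex c)) (trans (code-cong eq (vertex-in-range c)) (code-vertex c′))

  open Inverse Fin-size↔Code using (to; from; strictlyInverseˡ)

  enumeration : Enumeration V
  enumeration = record
    { size             = size
    ; decode           = λ x → vertex (to x)
    ; decode-injective = λ eq → Injection.injective (↔⇒↣ Fin-size↔Code) (vertex-injective eq)
    ; InRange          = InRange
    ; encode           = λ v p → from (code v p)
    ; decode-encode    = λ v p → trans (cong vertex (strictlyInverseˡ (code v p))) (vertex-code v p)
    }

  open Enumeration enumeration using (decode; encode; decode-encode)
  open GradedGraph E E? layer layer-step enumeration public

  div-mod : ∀ q → q % k + q / k * k ≡ q
  div-mod q = sym (m≡m%n+[m/n]*n q k)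

  LeftSibling⇒%< : ∀ {q q′} → LeftSibling q q′ → q % k < q′ % k
  LeftSibling⇒%< {q} {q′} (same , q<q′) = +-cancelʳ-< (q / k * k) (q % k) (q′ % k)
    (subst₂ _<_ (sym (div-mod q)) (trans (sym (div-mod q′)) (cong (λ p → q′ % k + p * k) (sym same))) q<q′)

  children : (ℕ → V) → ℕ → List V
  children F q = applyUpTo (λ y → F (y + q * k)) k

  left-siblings : (ℕ → V) → ℕ → List V
  left-siblings F q = applyUpTo (λ y → F (y + q / k * k)) (q % k)

  right-siblings : (ℕ → V) → ℕ → List V
  right-siblings F q = applyUpTo (λ y → F (y + suc (q % k) + q / k * k)) (k ∸ suc (q % k))

  ∈-children : ∀ F {q c} → q ≡ c / k → F c ∈ children F q
  ∈-children F {c = c} refl =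
    subst (_∈ children F (c / k)) (cong F (div-mod c)) (∈-applyUpTo⁺ (λ y → F (y + c / k * k)) (m%n<n c k))

  ∈-left-siblings : ∀ F {q q′} → LeftSibling q q′ → F q ∈ left-siblings F q′
  ∈-left-siblings F {q} {q′} sib@(same , _) =
    subst (_∈ left-siblings F q′) (cong F (trans (cong (λ p → q % k + p * k) (sym same)) (div-mod q)))
      (∈-applyUpTo⁺ (λ y → F (y + q′ / k * k)) (LeftSibling⇒%< sib))

  ∈-right-siblings : ∀ F {q q′} → LeftSibling q q′ → F q′ ∈ right-siblings F q
  ∈-right-siblings F {q} {q′} sib@(same , _) =
    subst (_∈ right-siblings F q) (cong F position) (∈-applyUpTo⁺ (λ y → F (y + suc (q % k) + q / k * k)) bound)
    where
    bound : q′ % k ∸ suc (q % k) < k ∸ suc (q % k)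
    bound = ∸-monoˡ-< (m%n<n q′ k) (LeftSibling⇒%< sib)
    position : q′ % k ∸ suc (q % k) + suc (q % k) + q / k * k ≡ q′
    position = trans (cong₂ _+_ (m∸n+n≡m (LeftSibling⇒%< sib)) (cong (_* k) same)) (div-mod q′)

  bridge-out : ℕ → ℕ → ℕ → V
  bridge-out q h q′ with suc h <? d ∸ h
  ... | yes _ = X q q′ h (suc h)
  ... | no _  = A q′ h

  bridge-in : ℕ → ℕ → ℕ → V
  bridge-in q′ h q with suc h <? d ∸ h
  ... | yes _ = X q q′ h (pred (d ∸ h))
  ... | no _  = B q h

  neighbours : V → List V
  neighbours (B q h)      = B (q / k) (suc h) ∷ children (λ c → B c (pred h)) q ++ right-siblings (bridge-out q h) q
  neighbours (A q h)      = A (q / k) (suc h) ∷ children (λ c → A c (pred h)) q ++ left-siblings (bridge-in q h) q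
  neighbours (X q q′ h t) = X q q′ h (suc t) ∷ A q′ h ∷ B q h ∷ X q q′ h (pred t) ∷ []

  out-neighbour : ∀ {v w} → E v w → w ∈ neighbours v
  out-neighbour {B q h} {B _ _} (refl , refl) = here refl
  out-neighbour {B q h} {A q′ _} (refl , sib , h+1≡d∸h) =
    there (∈-++⁺ʳ _ (subst (_∈ _) bridge-out≡A (∈-right-siblings (bridge-out q h) sib)))
    where
    bridge-out≡A : bridge-out q h q′ ≡ A q′ h
    bridge-out≡A with suc h <? d ∸ h
    ... | yes h+1<d∸h = ⊥-elim (<-irrefl h+1≡d∸h h+1<d∸h)
    ... | no _        = refl
  out-neighbour {B q h} {X _ q′ _ _} (refl , refl , sib , refl , h+1<d∸h) =
    there (∈-++⁺ʳ _ (subst (_∈ _) bridge-out≡X (∈-right-siblings (bridge-out q h) sib)))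
    where
    bridge-out≡X : bridge-out q h q′ ≡ X q q′ h (suc h)
    bridge-out≡X with suc h <? d ∸ h
    ... | yes _         = refl
    ... | no h+1≮d∸h    = ⊥-elim (h+1≮d∸h h+1<d∸h)
  out-neighbour {A q h} {A _ _} (refl , q≡c/k , _) = there (∈-++⁺ˡ (∈-children (λ c → A c _) q≡c/k))
  out-neighbour {X _ _ _ _} {X _ _ _ _} (refl , refl , refl , refl) = here refl
  out-neighbour {X _ _ _ _} {A _ _} (refl , refl , _) = there (here refl)
  out-neighbour {A _ _} {B _ _} ()
  out-neighbour {A _ _} {X _ _ _ _} ()
  out-neighbour {X _ _ _ _} {B _ _} ()

  in-neighbour : ∀ {v w} → E w v → w ∈ neighbours v
  in-neighbour {B q h} {B _ _} (refl , q≡c/k) = there (∈-++⁺ˡ (∈-children (λ c → B c _) q≡c/k))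
  in-neighbour {A q h} {A _ _} (refl , refl , _) = here refl
  in-neighbour {A q h} {B q₀ _} (refl , sib , h+1≡d∸h) =
    there (∈-++⁺ʳ _ (subst (_∈ _) bridge-in≡B (∈-left-siblings (bridge-in q h) sib)))
    where
    bridge-in≡B : bridge-in q h q₀ ≡ B q₀ h
    bridge-in≡B with suc h <? d ∸ h
    ... | yes h+1<d∸h = ⊥-elim (<-irrefl h+1≡d∸h h+1<d∸h)
    ... | no _        = refl
  in-neighbour {A q h} {X q₀ _ _ t} (refl , refl , sib , h<t , t+1≡d∸h) =
    there (∈-++⁺ʳ _ (subst (_∈ _) bridge-in≡X (∈-left-siblings (bridge-in q h) sib)))
    where
    bridge-in≡X : bridge-in q h q₀ ≡ X q₀ q h t
    bridge-in≡X with suc h <? d ∸ h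
    ... | yes _      = cong (λ t → X q₀ q h (pred t)) (sym t+1≡d∸h)
    ... | no h+1≮d∸h = ⊥-elim (h+1≮d∸h (subst (suc h <_) t+1≡d∸h (s≤s h<t)))
  in-neighbour {X _ _ _ _} {B _ _} (refl , refl , _) = there (there (here refl))
  in-neighbour {X _ _ _ _} {X _ _ _ _} (refl , refl , refl , refl) = there (there (there (here refl)))
  in-neighbour {B _ _} {A _ _} ()
  in-neighbour {X _ _ _ _} {A _ _} ()
  in-neighbour {B _ _} {X _ _ _ _} ()

  length-neighbours : ∀ v → length (neighbours v) ≤ (k + k) ⊔ 4
  length-neighbours (B q h) = begin
    length (neighbours (B q h))  ≡⟨ cong suc (length-++ (children F q)) ⟩
    suc (length (children F q) + length (right-siblings bridges q))
      ≡⟨ cong suc (cong₂ _+_ (length-applyUpTo _ k) (length-applyUpTo _ (k ∸ suc (q % k)))) ⟩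
    suc (k + (k ∸ suc (q % k)))  ≡⟨ +-suc k _ ⟨
    k + suc (k ∸ suc (q % k))    ≤⟨ +-monoʳ-≤ k (∸-monoʳ-< z<s (m%n<n q k)) ⟩
    k + k                        ≤⟨ m≤m⊔n (k + k) 4 ⟩
    (k + k) ⊔ 4                  ∎
    where
    open ≤-Reasoning
    F bridges : ℕ → V
    F c = B c (pred h)
    bridges = bridge-out q h
  length-neighbours (A q h) = begin
    length (neighbours (A q h))  ≡⟨ cong suc (length-++ (children F q)) ⟩
    suc (length (children F q) + length (left-siblings bridges q))
      ≡⟨ cong suc (cong₂ _+_ (length-applyUpTo _ k) (length-applyUpTo _ (q % k))) ⟩
    suc (k + q % k)              ≡⟨ +-suc k _ ⟨
    k + suc (q % k)              ≤⟨ +-monoʳ-≤ k (m%n<n q k) ⟩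
    k + k                        ≤⟨ m≤m⊔n (k + k) 4 ⟩
    (k + k) ⊔ 4                  ∎
    where
    open ≤-Reasoning
    F bridges : ℕ → V
    F c = A c (pred h)
    bridges = bridge-in q h
  length-neighbours (X _ _ _ _) = m≤n⊔m (k + k) 4

  max-degree : MaxDegreeAtMost graph ((k + k) ⊔ 4)
  max-degree x = ≤-trans (degree≤length neighbours out-neighbour in-neighbour x) (length-neighbours (decode x))

  ancestor : ℕ → ℕ → ℕ
  ancestor q zero    = q
  ancestor q (suc h) = ancestor q h / k

  ancestor≤ : ∀ q h → ancestor q h ≤ q
  ancestor≤ q zero    = ≤-refl
  ancestor≤ q (suc h) = ≤-trans (m/n≤m (ancestor q h) k) (ancestor≤ q h)

  ancestor-mono : ∀ {q q′} h → q ≤ q′ → ancestor q h ≤ ancestor q′ h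
  ancestor-mono zero    q≤q′ = q≤q′
  ancestor-mono (suc h) q≤q′ = /-monoˡ-≤ k (ancestor-mono h q≤q′)

  ancestor< : ∀ {q} c h → q < c * k ^ h → ancestor q h < c
  ancestor< {q} c zero    q<c*1  = subst (q <_) (*-identityʳ c) q<c*1
  ancestor< {q} c (suc h) q<c*kk = m<n*o⇒m/o<n (ancestor< (c * k) h (subst (q <_) (sym (*-assoc c k (k ^ h))) q<c*kk))

  ancestor<N : ∀ {q} h → q < N → ancestor q h < N
  ancestor<N {q} h q<N = ≤-<-trans (ancestor≤ q h) q<N

  m≤d : m ≤ d
  m≤d = s≤s (m≤m+n r r)

  h<m⇒h+1≤d∸h : ∀ {h} → h < m → suc h ≤ d ∸ h
  h<m⇒h+1≤d∸h {h} (s≤s h≤r) = begin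
    suc h        ≤⟨ s≤s h≤r ⟩
    suc r        ≡⟨ m+n∸n≡m (suc r) r ⟨
    d ∸ r        ≤⟨ ∸-monoʳ-≤ d h≤r ⟩
    d ∸ h        ∎
    where open ≤-Reasoning

  ascend : ∀ {i} → i < N → ∀ {h} → h < m → Star Forward (B i 0) (B (ancestor i h) h)
  ascend i<N {zero}  _      = ε
  ascend i<N {suc h} h+1<m = ascend i<N (<-trans (n<1+n h) h+1<m) ◅◅ ((ancestor<N (suc h) i<N , h+1<m) , refl , refl) ◅ ε

  descend : ∀ {j} → j < N → ∀ {h} → h < m → Star Forward (A (ancestor j h) h) (A j 0)
  descend j<N {zero}  _      = ε
  descend j<N {suc h} h+1<m =
    ((ancestor<N h j<N , h<m) , refl , refl , <⇒≤ (<-≤-trans h+1<m m≤d)) ◅ descend j<N h<m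
    where
    h<m : h < m
    h<m = <-trans (n<1+n h) h+1<m

  along-bridge : ∀ {q q′ h t u} → q < N → q′ < N → h < m → t ≤′ u → u ≤ d →
                 Star Forward (X q q′ h t) (X q q′ h u)
  along-bridge _ _ _ ≤′-refl _ = ε
  along-bridge q<N q′<N h<m (≤′-step t≤′u) u+1≤d =
    along-bridge q<N q′<N h<m t≤′u (<⇒≤ u+1≤d) ◅◅ ((q<N , q′<N , h<m , s≤s u+1≤d) , refl , refl , refl , refl) ◅ ε

  cross : ∀ {q q′ h} → LeftSibling q q′ → q < N → q′ < N → h < m → Star Forward (B q h) (A q′ h)
  cross {q} {q′} {h} sib q<N q′<N h<m with suc h <? d ∸ h
  ... | no h+1≮d∸h = ((q′<N , h<m) , refl , sib , ≤-antisym (h<m⇒h+1≤d∸h h<m) (≮⇒≥ h+1≮d∸h)) ◅ ε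
  ... | yes h+1<d∸h =
    ((q<N , q′<N , h<m , s≤s h<d) , refl , refl , sib , refl , h+1<d∸h)
      ◅ along-bridge q<N q′<N h<m (≤⇒≤′ h+1≤c) (m∸n≤m d (suc h))
      ◅◅ ((q′<N , h<m) , refl , refl , sib , h+1≤c , sym d∸h≡1+c) ◅ ε
    where
    h<d : h < d
    h<d = <-≤-trans h<m m≤d
    c : ℕ
    c = d ∸ suc h
    d∸h≡1+c : d ∸ h ≡ suc c
    d∸h≡1+c = m∸n≡1+m∸1+n h<d
    h+1≤c : suc h ≤ c
    h+1≤c = s≤s⁻¹ (subst (suc h <_) d∸h≡1+c h+1<d∸h)

  ancestor-at-root : ∀ {j} → j < N → ancestor j m ≡ 0
  ancestor-at-root {j} j<N = n<1⇒n≡0 (ancestor< 1 m (subst (j <_) (sym (*-identityˡ N)) j<N))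

  upper-path : ∀ {i j} → i < N → j < N → i < j → Star Forward (B i 0) (A j 0)
  upper-path {i} {j} i<N j<N i<j
    with h , h<m , i<j-at-h , i≮j-at-h+1 ←
           exit-point (λ h → ancestor i h <? ancestor j h) i<j (λ lt → n≮0 (subst (_ <_) (ancestor-at-root j<N) lt))
    = ascend i<N h<m ◅◅ cross (siblings , i<j-at-h) (ancestor<N h i<N) (ancestor<N h j<N) h<m ◅◅ descend j<N h<m
    where
    siblings : ancestor i h / k ≡ ancestor j h / k
    siblings = ≤-antisym (ancestor-mono (suc h) (<⇒≤ i<j)) (≮⇒≥ i≮j-at-h+1)

  -- i < (q + 1) k^h says ⌊i / k^h⌋ ≤ q, and i < q k^h says ⌊i / k^h⌋ < q.
  Before : ℕ → V → Set
  Before i (B q h)      = i < suc q * k ^ h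
  Before i (A q h)      = i < q * k ^ h
  Before i (X q q′ h t) = i < q′ * k ^ h

  Before-step : ∀ i {v w} → E v w → Before i v → Before i w
  Before-step i {B q h} {B _ _} (refl , refl) i<[q+1]k^h = <-≤-trans i<[q+1]k^h (begin
    suc q * k ^ h                  ≤⟨ *-monoˡ-≤ (k ^ h) q+1≤[q/k+1]k ⟩
    suc (q / k) * k * k ^ h        ≡⟨ *-assoc (suc (q / k)) k (k ^ h) ⟩
    suc (q / k) * (k * k ^ h)      ∎)
    where
    open ≤-Reasoning
    q+1≤[q/k+1]k : suc q ≤ suc (q / k) * k
    q+1≤[q/k+1]k = subst (λ p → suc p ≤ k + q / k * k) (div-mod q) (+-monoˡ-≤ (q / k * k) (m%n<n q k))
  Before-step i {A _ _} {A q h} (refl , refl , _) i<[q/k]kk^h = <-≤-trans i<[q/k]kk^h (begin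
    q / k * (k * k ^ h)            ≡⟨ *-assoc (q / k) k (k ^ h) ⟨
    q / k * k * k ^ h              ≤⟨ *-monoˡ-≤ (k ^ h) (m/n*n≤m q k) ⟩
    q * k ^ h                      ∎)
    where open ≤-Reasoning
  Before-step i {B q h} {A _ _}       (refl , (_ , q<q′) , _)     i<_ = <-≤-trans i<_ (*-monoˡ-≤ (k ^ h) q<q′)
  Before-step i {B q h} {X _ _ _ _}   (refl , refl , (_ , q<q′) , _) i<_ = <-≤-trans i<_ (*-monoˡ-≤ (k ^ h) q<q′)
  Before-step i {X _ _ _ _} {X _ _ _ _} (refl , refl , refl , _)   i<_ = i<_
  Before-step i {X _ _ _ _} {A _ _}     (refl , refl , _)          i<_ = i<_

  leaf : Fin N ⊎ Fin N → V
  leaf (inj₁ j) = A (toℕ j) 0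
  leaf (inj₂ i) = B (toℕ i) 0

  leaf-in-range : ∀ a → InRange (leaf a)
  leaf-in-range (inj₁ j) = toℕ<n j , z<s
  leaf-in-range (inj₂ i) = toℕ<n i , z<s

  index : V → ℕ
  index (B q _)       = q
  index (A q _)       = q
  index (X q _ _ _)   = q

  leaf-injective : Injective _≡_ _≡_ leaf
  leaf-injective {inj₁ _} {inj₁ _} eq = cong inj₁ (toℕ-injective (cong index eq))
  leaf-injective {inj₂ _} {inj₂ _} eq = cong inj₂ (toℕ-injective (cong index eq))
  leaf-injective {inj₁ _} {inj₂ _} ()
  leaf-injective {inj₂ _} {inj₁ _} ()

  half-graph : HalfGraph graph d N
  half-graph = record
    { f        = λ a → encode (leaf a) (leaf-in-range a)
    ; distinct = λ {a} {a′} eq →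
        leaf-injective (trans (sym (decode-encode (leaf a) _)) (trans (cong decode eq) (decode-encode (leaf a′) _)))
    ; half     = λ i j → lower (toℕ i) (toℕ j) , upper (toℕ<n i) (toℕ<n j)
    }
    where
    upper : ∀ {i j} (i<N : i < N) (j<N : j < N) → i < j →
            DistLe graph (encode (B i 0) (i<N , z<s)) (encode (A j 0) (j<N , z<s)) d
    upper i<N j<N i<j with l , walk , climb ← forward-walk (upper-path i<N j<N i<j) (i<N , z<s) (j<N , z<s) =
      l , ≤-reflexive (sym (trans climb (+-identityʳ l))) , walk
    lower : ∀ i j .{i<N : i < N} .{j<N : j < N} →
            DistLe graph (encode (B i 0) (i<N , z<s)) (encode (A j 0) (j<N , z<s)) d → i < j
    lower i j {i<N} {j<N} (l , l≤d , walk) = subst (i <_) (*-identityʳ j)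
      (short-walk-preserves (Before-step i) {B i 0} {A j 0} {p = i<N , z<s} {q = j<N , z<s} walk (subst (_≤ d) (sym (+-identityʳ l)) l≤d)
        (subst (i <_) (sym (*-identityʳ (suc i))) (n<1+n i)))

ceilHalf-odd : ∀ r → ceilHalf (suc (r + r)) ≡ suc r
ceilHalf-odd r = trans (cong (_/ 2) 2r+2≡[r+1]*2) (m*n/n≡m (suc r) 2)
  where
  2r+2≡[r+1]*2 : suc (r + r) + 1 ≡ suc r * 2
  2r+2≡[r+1]*2 = trans (+-comm (suc (r + r)) 1)
                   (cong (2 +_) (trans (cong (r +_) (sym (+-identityʳ r))) (*-comm 2 r)))

theorem3p1 : (Δ d : ℕ) → 4 ≤ Δ → Odd d →
    Σ Graph λ G → MaxDegreeAtMost G Δ × HalfGraph G d ((Δ / 2) ^ ceilHalf d)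
theorem3p1 Δ _ 4≤Δ (r , refl) rewrite ceilHalf-odd r =
  graph , (λ x → ≤-trans (max-degree x) (⊔-lub k+k≤Δ 4≤Δ)) , half-graph
  where
  k : ℕ
  k = Δ / 2
  instance
    k≢0 : NonZero k
    k≢0 = >-nonZero (<-≤-trans z<s (/-monoˡ-≤ 2 4≤Δ))
  open HalfGraphConstruction k r
  k+k≤Δ : k + k ≤ Δ
  k+k≤Δ = subst (_≤ Δ) (trans (*-comm k 2) (cong (k +_) (+-identityʳ k))) (m/n*n≤m Δ 2)
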